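{- Let $\epsilon>0$ be a constant and let $G$ be a $d$-degenerate graph. Consider the following procedure (which does not use the value of $d$): start with an empty list $L$; while $G$ is nonempty, let $n$ be the current number of vertices of $G$, let $S$ be a set of $\lceil n\epsilon/(2+\epsilon)\rceil$ vertices of smallest degree in the current graph $G$, append the vertices of $S$ (in any order) to the end of $L$, and delete $S$ and all incident edges from $G$; finally return $L$. Then the returned list $L$ is a $(2+\epsilon)d$-degeneracy ordering of the original graph $G$.
   Context: Graphs are finite, undirected and simple. A graph is $d$-degenerate if its $k$-core number is $d$, i.e. $d$ is the largest $k$ such that the graph has a nonempty subgraph of minimum degree at least $k$; equivalently every nonempty subgraph has a vertex of degree at most $d$. A $\delta$-degeneracy ordering of a graph is a linear ordering of all its vertices such that every vertex has at most $\delta$ neighbors that appear after it in the ordering.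
   Formalization: The constant ε ranges over the positive rationals. -}

module Defs where

open import Data.Nat as ℕ using (ℕ; zero; suc; _+_; _≤_)
open import Data.Bool using (Bool; true; false; if_then_else_)
open import Data.Fin using (Fin)
open import Data.Fin.Subset as Sub using (Subset; _∈_; _∉_; _⊆_; _─_; ∣_∣; Nonempty; Empty)
open import Data.Vec using (lookup)
open import Data.List using (List; []; _∷_; _++_; allFin; map)
open import Data.Nat.ListAction using (sum)
open import Data.List.Relation.Unary.Unique.Propositional using (Unique)
import Data.List.Membership.Propositional as LM
open import Data.Integer using (ℤ; +_)
open import Data.Rational as ℚ using (ℚ; 0ℚ; _÷_; _<_; floor; ceiling; _/_)
open import Data.Rational.Properties using (pos+pos⇒pos; pos⇒nonZero)
open import Data.Product using (Σ; ∃; _×_; _,_)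
open import Data.Unit using () renaming (⊤ to Unit; tt to unit)
open import Relation.Binary.PropositionalEquality using (_≡_)
open import Function.Bundles using (_⇔_)

record Graph (n : ℕ) : Set where
  field
    adj    : Fin n → Fin n → Bool
    sym    : ∀ u v → adj u v ≡ adj v u
    irrefl : ∀ v → adj v v ≡ false
open Graph public

private
  b2n : Bool → ℕ
  b2n true  = 1
  b2n false = 0

-- degree of v in the induced subgraph G[R] (number of neighbours of v lying in R)
deg : ∀ {n} → Graph n → Subset n → Fin n → ℕ
deg {n} G R v = sum (map (λ u → b2n (if lookup R u then adj G v u else false)) (allFin n))

-- G has a nonempty subgraph of minimum degree at least k
-- (taken as an induced subgraph G[R])
HasCore : ∀ {n} → Graph n → ℕ → Set
HasCore {n} G k = Σ (Subset n) λ R → Nonempty R × (∀ v → v ∈ R → k ≤ deg G R v)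

-- G is d-degenerate: its k-core number (largest k with a k-core) is d
Degenerate : ∀ {n} → Graph n → ℕ → Set
Degenerate G d = HasCore G d × (∀ k → HasCore G k → k ≤ d)

batchSize : (ε : ℚ) → 0ℚ < ε → ℕ → ℤ
batchSize ε ε>0 m =
  ceiling (_÷_ ((+ m / 1) ℚ.* ε) ((+ 2 / 1) ℚ.+ ε)
             {{pos⇒nonZero ((+ 2 / 1) ℚ.+ ε)
                 {{pos+pos⇒pos (+ 2 / 1) ε {{ℚ.positive ε>0}}}}}})

-- Possible runs of the procedure.  Run G ε ε>0 R L : starting from the
-- current graph G[R] (R = set of remaining vertices), the procedure may
-- output (append) exactly the list L.
data Run {n : ℕ} (G : Graph n) (ε : ℚ) (ε>0 : 0ℚ < ε) : Subset n → List (Fin n) → Set where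
  done : ∀ {R} → Empty R → Run G ε ε>0 R []
  step : ∀ {R S ℓS ℓ} →
         Nonempty R →
         S ⊆ R →
         + ∣ S ∣ ≡ batchSize ε ε>0 ∣ R ∣ →
         (∀ v w → v ∈ S → w ∈ R → w ∉ S → deg G R v ≤ deg G R w) →
         Unique ℓS →
         (∀ v → (v ∈ S) ⇔ (v LM.∈ ℓS)) →
         Run G ε ε>0 (R ─ S) ℓ →
         Run G ε ε>0 R (ℓS ++ ℓ)

nbrsIn : ∀ {n} → Graph n → Fin n → List (Fin n) → ℕ
nbrsIn G v []       = 0
nbrsIn G v (u ∷ us) = b2n (adj G v u) + nbrsIn G v us

AfterBound : ∀ {n} → Graph n → ℚ → List (Fin n) → Set
AfterBound G δ []       = Unit
AfterBound G δ (v ∷ us) = ((+ nbrsIn G v us / 1) ℚ.≤ δ) × AfterBound G δ us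

IsDegeneracyOrdering : ∀ {n} → Graph n → ℚ → List (Fin n) → Set
IsDegeneracyOrdering {n} G δ L = (∀ (v : Fin n) → v LM.∈ L) × Unique L × AfterBound G δ L

module Submission where

-- Let R be the set of vertices still present when a batch S is removed,
-- m = |R|, s = |S| = ⌈mε/(2+ε)⌉ and t = |R ─ S|.  Since G has no
-- (d+1)-core, every nonempty G[R] has a vertex of degree ≤ d; deleting such
-- vertices one at a time shows that the degree sum of G[R] is at most 2dm.
-- Every vertex v of S has degree D no larger than any vertex of R ─ S, so
-- (t+1)·D ≤ 2dm.  The choice of s forces t + 1 > 2m/(2+ε), hence
-- D ≤ (2+ε)d.  Finally, the neighbours of v listed after v all lie in R, so
-- there are at most D of them.

module SubsetSums where

  open import Data.Nat as ℕ using (ℕ; zero; suc; _+_; _*_; _≤_; z≤n)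
  import Data.Nat.Properties as ℕ
  open import Algebra.Properties.CommutativeSemigroup ℕ.+-commutativeSemigroup
    using (interchange; x∙yz≈y∙xz)
  open import Data.Fin using (Fin; zero; suc)
  open import Data.Fin.Subset
    using (Subset; inside; outside; _∈_; _∉_; _⊆_; _─_; _-_; ⁅_⁆; ⊥; ∣_∣; Empty)
  open import Data.Fin.Subset.Properties
    using (drop-∷-⊆; Empty-unique; x∈⁅y⁆⇒x≡y; x∈p∧x≢y⇒x∈p-y; ∣⁅x⁆∣≡1)
  open import Data.Vec using ([]; _∷_; here; there)
  open import Data.List using (List; []; _∷_; map)
  open import Data.Nat.ListAction using (sum)
  open import Data.List.Membership.Propositional using () renaming (_∈_ to _∈ₗ_)
  open import Data.List.Relation.Unary.All as All using ()
  open import Data.List.Relation.Unary.Any using () renaming (here to hereₗ; there to thereₗ)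
  open import Data.List.Relation.Unary.AllPairs using ([]; _∷_)
  open import Data.List.Relation.Unary.Unique.Propositional using (Unique)
  open import Relation.Binary.PropositionalEquality
  open import Function using (_∘_)

  private
    variable
      n : ℕ

  ∑∈ : Subset n → (Fin n → ℕ) → ℕ
  ∑∈ []            f = 0
  ∑∈ (inside  ∷ R) f = f zero + ∑∈ R (f ∘ suc)
  ∑∈ (outside ∷ R) f = ∑∈ R (f ∘ suc)

  ∑∈-cong : (R : Subset n) {f g : Fin n → ℕ} → (∀ u → f u ≡ g u) → ∑∈ R f ≡ ∑∈ R g
  ∑∈-cong []            f≗g = refl
  ∑∈-cong (inside  ∷ R) f≗g = cong₂ _+_ (f≗g zero) (∑∈-cong R (f≗g ∘ suc))
  ∑∈-cong (outside ∷ R) f≗g = ∑∈-cong R (f≗g ∘ suc)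

  ∑∈-+ : (R : Subset n) (f g : Fin n → ℕ) → ∑∈ R (λ u → f u + g u) ≡ ∑∈ R f + ∑∈ R g
  ∑∈-+ []            f g = refl
  ∑∈-+ (inside  ∷ R) f g =
    trans (cong (f zero + g zero +_) (∑∈-+ R (f ∘ suc) (g ∘ suc)))
          (interchange (f zero) (g zero) (∑∈ R (f ∘ suc)) (∑∈ R (g ∘ suc)))
  ∑∈-+ (outside ∷ R) f g = ∑∈-+ R (f ∘ suc) (g ∘ suc)

  ∑∈-mono : {S R : Subset n} {f g : Fin n → ℕ} →
            S ⊆ R → (∀ {u} → u ∈ S → f u ≤ g u) → ∑∈ S f ≤ ∑∈ R g
  ∑∈-mono {S = []}          {[]}          S⊆R f≤g = z≤n
  ∑∈-mono {S = inside  ∷ S} {inside  ∷ R} S⊆R f≤g =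
    ℕ.+-mono-≤ (f≤g here) (∑∈-mono (drop-∷-⊆ S⊆R) (f≤g ∘ there))
  ∑∈-mono {S = inside  ∷ S} {outside ∷ R} S⊆R f≤g with () ← S⊆R here
  ∑∈-mono {S = outside ∷ S} {inside  ∷ R} {g = g} S⊆R f≤g =
    ℕ.≤-trans (∑∈-mono (drop-∷-⊆ S⊆R) (f≤g ∘ there)) (ℕ.m≤n+m _ (g zero))
  ∑∈-mono {S = outside ∷ S} {outside ∷ R} S⊆R f≤g = ∑∈-mono (drop-∷-⊆ S⊆R) (f≤g ∘ there)

  ∑∈-split : {S R : Subset n} (f : Fin n → ℕ) → S ⊆ R → ∑∈ R f ≡ ∑∈ (R ─ S) f + ∑∈ S f
  ∑∈-split {S = []}          {[]}          f S⊆R = refl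
  ∑∈-split {S = inside  ∷ S} {inside  ∷ R} f S⊆R =
    trans (cong (f zero +_) (∑∈-split (f ∘ suc) (drop-∷-⊆ S⊆R)))
          (x∙yz≈y∙xz (f zero) (∑∈ (R ─ S) (f ∘ suc)) (∑∈ S (f ∘ suc)))
  ∑∈-split {S = outside ∷ S} {inside  ∷ R} f S⊆R =
    trans (cong (f zero +_) (∑∈-split (f ∘ suc) (drop-∷-⊆ S⊆R)))
          (sym (ℕ.+-assoc (f zero) (∑∈ (R ─ S) (f ∘ suc)) (∑∈ S (f ∘ suc))))
  ∑∈-split {S = inside  ∷ S} {outside ∷ R} f S⊆R with () ← S⊆R here
  ∑∈-split {S = outside ∷ S} {outside ∷ R} f S⊆R = ∑∈-split (f ∘ suc) (drop-∷-⊆ S⊆R)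

  ∑∈-⊥ : (f : Fin n → ℕ) → ∑∈ ⊥ f ≡ 0
  ∑∈-⊥ {zero}  f = refl
  ∑∈-⊥ {suc n} f = ∑∈-⊥ (f ∘ suc)

  ∑∈-⁅⁆ : (v : Fin n) (f : Fin n → ℕ) → ∑∈ ⁅ v ⁆ f ≡ f v
  ∑∈-⁅⁆ zero    f = trans (cong (f zero +_) (∑∈-⊥ (f ∘ suc))) (ℕ.+-identityʳ (f zero))
  ∑∈-⁅⁆ (suc v) f = ∑∈-⁅⁆ v (f ∘ suc)

  ∑∈-empty : {R : Subset n} (f : Fin n → ℕ) → Empty R → ∑∈ R f ≡ 0
  ∑∈-empty f empty = trans (cong (λ R → ∑∈ R f) (Empty-unique empty)) (∑∈-⊥ f)

  ∑∈-const : (R : Subset n) (c : ℕ) → ∑∈ R (λ _ → c) ≡ ∣ R ∣ * c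
  ∑∈-const []            c = refl
  ∑∈-const (inside  ∷ R) c = cong (c +_) (∑∈-const R c)
  ∑∈-const (outside ∷ R) c = ∑∈-const R c

  ⁅⁆⊆ : {v : Fin n} {R : Subset n} → v ∈ R → ⁅ v ⁆ ⊆ R
  ⁅⁆⊆ {v = v} v∈R u∈⁅v⁆ = subst (_∈ _) (sym (x∈⁅y⁆⇒x≡y v u∈⁅v⁆)) v∈R

  ∑∈-remove : {v : Fin n} {R : Subset n} (f : Fin n → ℕ) → v ∈ R → ∑∈ R f ≡ ∑∈ (R - v) f + f v
  ∑∈-remove {v = v} {R} f v∈R = trans (∑∈-split f (⁅⁆⊆ v∈R)) (cong (∑∈ (R - v) f +_) (∑∈-⁅⁆ v f))

  ∑∈-list : {R : Subset n} (f : Fin n → ℕ) {us : List (Fin n)} →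
            Unique us → (∀ {u} → u ∈ₗ us → u ∈ R) → sum (map f us) ≤ ∑∈ R f
  ∑∈-list f {[]}     []             us⊆R = z≤n
  ∑∈-list {R = R} f {u ∷ us} (u∉us ∷ uniq) us⊆R = begin
    f u + sum (map f us)   ≤⟨ ℕ.+-monoʳ-≤ (f u) (∑∈-list f uniq us⊆R-u) ⟩
    f u + ∑∈ (R - u) f     ≡⟨ ℕ.+-comm (f u) _ ⟩
    ∑∈ (R - u) f + f u     ≡⟨ sym (∑∈-remove f (us⊆R (hereₗ refl))) ⟩
    ∑∈ R f                 ∎
    where
    open ℕ.≤-Reasoning
    us⊆R-u : ∀ {w} → w ∈ₗ us → w ∈ R - u
    us⊆R-u w∈us = x∈p∧x≢y⇒x∈p-y (us⊆R (thereₗ w∈us)) (λ w≡u → All.lookup u∉us w∈us (sym w≡u))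

  ∣∣-∑∈ : (R : Subset n) → ∣ R ∣ ≡ ∑∈ R (λ _ → 1)
  ∣∣-∑∈ R = sym (trans (∑∈-const R 1) (ℕ.*-identityʳ ∣ R ∣))

  ∣∣-split : {S R : Subset n} → S ⊆ R → ∣ R ∣ ≡ ∣ R ─ S ∣ + ∣ S ∣
  ∣∣-split {S = S} {R} S⊆R = begin
    ∣ R ∣                                  ≡⟨ ∣∣-∑∈ R ⟩
    ∑∈ R (λ _ → 1)                         ≡⟨ ∑∈-split (λ _ → 1) S⊆R ⟩
    ∑∈ (R ─ S) (λ _ → 1) + ∑∈ S (λ _ → 1)  ≡⟨ sym (cong₂ _+_ (∣∣-∑∈ (R ─ S)) (∣∣-∑∈ S)) ⟩
    ∣ R ─ S ∣ + ∣ S ∣                      ∎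
    where open ≡-Reasoning

  ∣∣-remove : {v : Fin n} {R : Subset n} → v ∈ R → ∣ R ∣ ≡ suc ∣ R - v ∣
  ∣∣-remove {v = v} {R} v∈R =
    trans (∣∣-split (⁅⁆⊆ v∈R)) (trans (cong (∣ R - v ∣ +_) (∣⁅x⁆∣≡1 v)) (ℕ.+-comm ∣ R - v ∣ 1))

  ∈─⇒∉ : {x : Fin n} (p q : Subset n) → x ∈ p ─ q → x ∉ q
  ∈─⇒∉ (_ ∷ p) (outside ∷ q) here       ()
  ∈─⇒∉ (_ ∷ p) (_       ∷ q) (there x∈) (there x∈q) = ∈─⇒∉ p q x∈ x∈q

module InducedDegrees where

  open SubsetSums
  open import Defs hiding (sym)
  open import Data.Nat as ℕ using (ℕ; zero; suc; _+_; _*_; _≤_; z≤n; _≤?_)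
  import Data.Nat.Properties as ℕ
  open import Data.Bool using (Bool; false; if_then_else_)
  open import Data.Fin using (Fin; zero; suc)
  open import Data.Fin.Properties using (any?)
  open import Data.Fin.Subset
    using (Subset; inside; outside; _∈_; _∉_; _⊆_; _─_; _-_; ⁅_⁆; ∣_∣; Nonempty)
  open import Data.Fin.Subset.Properties using (_∈?_; nonempty?; p─q⊆p)
  open import Data.Vec using ([]; _∷_; lookup)
  open import Data.List using ([]; _∷_; tabulate)
  open import Data.List.Properties using (map-tabulate)
  open import Data.Nat.ListAction using (sum)
  open import Data.Product using (∃; _×_; _,_)
  open import Relation.Nullary using (¬_; yes; no; contradiction)
  open import Relation.Nullary.Decidable using (_×-dec_)
  open import Relation.Binary.PropositionalEquality
  open import Function using (_∘_)

  private
    variable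
      n : ℕ

  -- Defs counts edges with a Boolean indicator that it keeps private.  On the
  -- graph with two vertices joined iff b, nbrsIn unfolds to (indicator b + 0),
  -- so unification recovers the indicator as χ; with χ in hand, deg and nbrsIn
  -- unfold to expressions that can be stated here.
  edgeGraph : Bool → Graph 2
  edgeGraph b = record { adj = edge ; sym = edge-sym ; irrefl = edge-irrefl }
    where
    edge : Fin 2 → Fin 2 → Bool
    edge zero (suc zero) = b
    edge (suc zero) zero = b
    edge _ _ = false
    edge-sym : ∀ u v → edge u v ≡ edge v u
    edge-sym zero       zero       = refl
    edge-sym zero       (suc zero) = refl
    edge-sym (suc zero) zero       = refl
    edge-sym (suc zero) (suc zero) = refl
    edge-irrefl : ∀ v → edge v v ≡ false
    edge-irrefl zero       = refl
    edge-irrefl (suc zero) = refl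

  indicatorOf : {h : Bool → ℕ} → (∀ b → h b + 0 ≡ nbrsIn (edgeGraph b) zero (suc zero ∷ [])) →
                Bool → ℕ
  indicatorOf {h} _ = h

  χ : Bool → ℕ
  χ = indicatorOf (λ b → refl)

  deg-∑∈ : (G : Graph n) (R : Subset n) (v : Fin n) → deg G R v ≡ ∑∈ R (λ u → χ (adj G v u))
  deg-∑∈ G R v =
    trans (cong sum (map-tabulate (λ u → u) (λ u → χ (if lookup R u then adj G v u else false))))
          (tabulated R (adj G v))
    where
    tabulated : ∀ {k} (R : Subset k) (g : Fin k → Bool) →
                sum (tabulate (λ u → χ (if lookup R u then g u else false))) ≡ ∑∈ R (χ ∘ g)
    tabulated []            g = refl
    tabulated (inside  ∷ R) g = cong (χ (g zero) +_) (tabulated R (g ∘ suc))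
    tabulated (outside ∷ R) g = tabulated R (g ∘ suc)

  deg-remove : (G : Graph n) {v : Fin n} {R : Subset n} (w : Fin n) → v ∈ R →
               deg G R w ≡ deg G (R - v) w + χ (adj G w v)
  deg-remove G {v} {R} w v∈R = begin
    deg G R w                                           ≡⟨ deg-∑∈ G R w ⟩
    ∑∈ R (λ u → χ (adj G w u))                          ≡⟨ ∑∈-remove _ v∈R ⟩
    ∑∈ (R - v) (λ u → χ (adj G w u)) + χ (adj G w v)
      ≡⟨ cong (_+ χ (adj G w v)) (sym (deg-∑∈ G (R - v) w)) ⟩
    deg G (R - v) w + χ (adj G w v)                     ∎
    where open ≡-Reasoning

  degSum : Graph n → Subset n → ℕ
  degSum G R = ∑∈ R (deg G R)

  -- Deleting v from R removes deg v edges, each counted twice.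
  degSum-remove : (G : Graph n) {v : Fin n} {R : Subset n} → v ∈ R →
                  degSum G R ≡ degSum G (R - v) + 2 * deg G R v
  degSum-remove G {v} {R} v∈R = begin
    ∑∈ R (deg G R)
      ≡⟨ ∑∈-remove (deg G R) v∈R ⟩
    ∑∈ (R - v) (deg G R) + D
      ≡⟨ cong (_+ D) (∑∈-cong (R - v) (λ w → deg-remove G w v∈R)) ⟩
    ∑∈ (R - v) (λ w → deg G (R - v) w + χ (adj G w v)) + D
      ≡⟨ cong (_+ D) (∑∈-+ (R - v) (deg G (R - v)) (λ w → χ (adj G w v))) ⟩
    degSum G (R - v) + ∑∈ (R - v) (λ w → χ (adj G w v)) + D
      ≡⟨ cong (λ x → degSum G (R - v) + x + D) edges-at-v ⟩
    degSum G (R - v) + D + D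
      ≡⟨ ℕ.+-assoc (degSum G (R - v)) D D ⟩
    degSum G (R - v) + (D + D)
      ≡⟨ cong (λ x → degSum G (R - v) + (D + x)) (sym (ℕ.+-identityʳ D)) ⟩
    degSum G (R - v) + 2 * D ∎
    where
    open ≡-Reasoning
    D = deg G R v
    edges-at-v : ∑∈ (R - v) (λ w → χ (adj G w v)) ≡ D
    edges-at-v = begin
      ∑∈ (R - v) (λ w → χ (adj G w v))   ≡⟨ ∑∈-cong (R - v) (λ w → cong χ (Graph.sym G w v)) ⟩
      ∑∈ (R - v) (λ w → χ (adj G v w))   ≡⟨ sym (deg-∑∈ G (R - v) v) ⟩
      deg G (R - v) v                     ≡⟨ sym (ℕ.+-identityʳ _) ⟩
      deg G (R - v) v + χ false           ≡⟨ cong (λ b → deg G (R - v) v + χ b) (sym (irrefl G v)) ⟩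
      deg G (R - v) v + χ (adj G v v)     ≡⟨ sym (deg-remove G v v∈R) ⟩
      D                                   ∎

  sparse-vertex : {G : Graph n} {d : ℕ} {R : Subset n} →
                  ¬ HasCore G (suc d) → Nonempty R → ∃ λ v → v ∈ R × deg G R v ≤ d
  sparse-vertex {G = G} {d} {R} noCore nonempty
    with any? (λ v → v ∈? R ×-dec deg G R v ≤? d)
  ... | yes sparse = sparse
  ... | no ¬sparse = contradiction core noCore
    where
    core : HasCore G (suc d)
    core = R , nonempty , λ v v∈R → ℕ.≰⇒> (λ small → ¬sparse (v , v∈R , small))

  -- Hence, peeling sparse vertices, G[R] has degree sum at most 2d|R|.
  degSum-bound : {G : Graph n} {d : ℕ} → ¬ HasCore G (suc d) → (R : Subset n) →
                 degSum G R ≤ ∣ R ∣ * (2 * d)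
  degSum-bound {G = G} {d} noCore R = peel ∣ R ∣ R refl
    where
    peel : ∀ k R → ∣ R ∣ ≡ k → degSum G R ≤ k * (2 * d)
    peel k R size with nonempty? R
    peel k       R size | no empty =
      ℕ.≤-trans (ℕ.≤-reflexive (∑∈-empty (deg G R) empty)) z≤n
    peel zero    R size | yes (v , v∈R) =
      contradiction (trans (sym size) (∣∣-remove v∈R)) (ℕ.0≢1+n {∣ R - v ∣})
    peel (suc k) R size | yes nonempty with sparse-vertex {G = G} {d} noCore nonempty
    ... | v , v∈R , small = begin
      degSum G R                         ≡⟨ degSum-remove G v∈R ⟩
      degSum G (R - v) + 2 * deg G R v
        ≤⟨ ℕ.+-mono-≤ (peel k (R - v) size-v) (ℕ.*-monoʳ-≤ 2 small) ⟩
      k * (2 * d) + 2 * d                ≡⟨ ℕ.+-comm (k * (2 * d)) (2 * d) ⟩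
      suc k * (2 * d)                    ∎
      where
      open ℕ.≤-Reasoning
      size-v : ∣ R - v ∣ ≡ k
      size-v = ℕ.suc-injective (trans (sym (∣∣-remove v∈R)) size)

  LowestDegrees : Graph n → Subset n → Subset n → Set
  LowestDegrees G R S = ∀ v w → v ∈ S → w ∈ R → w ∉ S → deg G R v ≤ deg G R w

  -- A lowest-degree vertex v ∈ S ⊆ R has degree at most that of each of the
  -- |R ─ S| vertices left behind, so (|R ─ S| + 1)·deg v ≤ degSum G R.
  batch-degree : (G : Graph n) {R S : Subset n} {v : Fin n} →
                 S ⊆ R → LowestDegrees G R S → v ∈ S → suc ∣ R ─ S ∣ * deg G R v ≤ degSum G R
  batch-degree G {R} {S} {v} S⊆R lowest v∈S = begin
    suc ∣ R ─ S ∣ * D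
      ≡⟨ ℕ.+-comm D (∣ R ─ S ∣ * D) ⟩
    ∣ R ─ S ∣ * D + D
      ≡⟨ sym (cong₂ _+_ (∑∈-const (R ─ S) D) (∑∈-⁅⁆ v (deg G R))) ⟩
    ∑∈ (R ─ S) (λ _ → D) + ∑∈ ⁅ v ⁆ (deg G R)
      ≤⟨ ℕ.+-mono-≤ (∑∈-mono (λ w∈ → w∈) D≤) (∑∈-mono (⁅⁆⊆ v∈S) (λ _ → ℕ.≤-refl)) ⟩
    ∑∈ (R ─ S) (deg G R) + ∑∈ S (deg G R)
      ≡⟨ sym (∑∈-split (deg G R) S⊆R) ⟩
    degSum G R ∎
    where
    open ℕ.≤-Reasoning
    D = deg G R v
    D≤ : ∀ {w} → w ∈ R ─ S → D ≤ deg G R w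
    D≤ {w} w∈R─S = lowest v w v∈S (p─q⊆p R S w∈R─S) (∈─⇒∉ R S w∈R─S)

-- Rational arithmetic: from (t+1)·D ≤ 2dm and the batch size to D ≤ (2+ε)d.
module Arithmetic where

  open import Defs using (batchSize)
  open import Data.Nat as ℕ using (ℕ; suc)
  open import Data.Integer as ℤ using (ℤ; +_; 1ℤ)
  import Data.Integer.Properties as ℤ
  open import Data.Integer.DivMod using (div-pos-is-/ℕ; n<s[n/ℕd]*d)
  open import Data.Nat.Coprimality using (1-coprimeTo) renaming (sym to coprime-sym)
  open import Data.Rational
    using (ℚ; mkℚ; 0ℚ; 1ℚ; _<_; _≤_; _+_; _*_; -_; _/_; _÷_; floor; ceiling; ↥_; ↧_;
           Positive; NonNegative; NonZero; positive; 1/_; *≤*; *<*)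
  open import Data.Rational.Properties
  open import Relation.Binary.PropositionalEquality
  open import Function using (_∘_)

  toℚ : ℕ → ℚ
  toℚ a = + a / 1

  -- Integers as rationals in normal form; toℚ lands there, which makes the
  -- rational operations on embedded naturals compute.

  fromℤ : ℤ → ℚ
  fromℤ z = mkℚ z 0 (coprime-sym (1-coprimeTo _))

  toℚ≡fromℤ : ∀ a → toℚ a ≡ fromℤ (+ a)
  toℚ≡fromℤ a = normalize-coprime (coprime-sym (1-coprimeTo a))

  toℚ-+ : ∀ a b → toℚ (a ℕ.+ b) ≡ toℚ a + toℚ b
  toℚ-+ a b = begin
    + (a ℕ.+ b) / 1
      ≡⟨ cong (_/ 1) (trans (ℤ.pos-+ a b)
                            (sym (cong₂ ℤ._+_ (ℤ.*-identityʳ (+ a)) (ℤ.*-identityʳ (+ b))))) ⟩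
    fromℤ (+ a) + fromℤ (+ b)      ≡⟨ sym (cong₂ _+_ (toℚ≡fromℤ a) (toℚ≡fromℤ b)) ⟩
    toℚ a + toℚ b                  ∎
    where open ≡-Reasoning

  toℚ-* : ∀ a b → toℚ (a ℕ.* b) ≡ toℚ a * toℚ b
  toℚ-* a b = trans (cong (_/ 1) (ℤ.pos-* a b)) (sym (cong₂ _*_ (toℚ≡fromℤ a) (toℚ≡fromℤ b)))

  toℚ-mono-≤ : ∀ {a b} → a ℕ.≤ b → toℚ a ≤ toℚ b
  toℚ-mono-≤ {a} {b} a≤b rewrite toℚ≡fromℤ a | toℚ≡fromℤ b =
    *≤* (subst₂ ℤ._≤_ (sym (ℤ.*-identityʳ (+ a))) (sym (ℤ.*-identityʳ (+ b))) (ℤ.+≤+ a≤b))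

  -- Unfolding floor on a rational that is not a literal record.
  floor-def : ∀ p → floor p ≡ ↥ p ℤ./ ↧ p
  floor-def (mkℚ _ _ _) = refl

  div-cong : ∀ {i j d e : ℤ} .{{_ : ℤ.NonZero d}} .{{_ : ℤ.NonZero e}} →
             i ≡ j → d ≡ e → i ℤ./ d ≡ j ℤ./ e
  div-cong refl refl = refl

  fromℤ-+1 : ∀ z → fromℤ z + 1ℚ ≡ (z ℤ.+ 1ℤ) / 1
  fromℤ-+1 z = cong (λ w → (w ℤ.+ 1ℤ) / 1) (ℤ.*-identityʳ z)

  ceiling-< : ∀ x {s} → + s ≡ ceiling x → toℚ s < x + 1ℚ
  ceiling-< x@(mkℚ a b _) {s} s≡⌈x⌉ = begin-strict
    toℚ s
      ≡⟨ cong (_/ 1) (solve 1 (λ s → s := (s :- con 1ℤ) :+ con 1ℤ) refl (+ s)) ⟩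
    (+ s ℤ.- 1ℤ ℤ.+ 1ℤ) / 1     ≡⟨ sym (fromℤ-+1 (+ s ℤ.- 1ℤ)) ⟩
    fromℤ (+ s ℤ.- 1ℤ) + 1ℚ     <⟨ +-monoˡ-< 1ℚ s-1<x ⟩
    x + 1ℚ                      ∎
    where
    open ≤-Reasoning
    open import Data.Integer.Solver using (module +-*-Solver)
    open +-*-Solver
    D = + suc b
    -- ceiling x = - F with F = ⌊ - a / D ⌋, and - a < (F + 1)·D
    F = ℤ.- a ℤ./ D
    ⌈x⌉≡-F : ceiling x ≡ ℤ.- F
    ⌈x⌉≡-F = cong ℤ.-_ (trans (floor-def (- x)) (div-cong (↥-neg x) (↧-neg x)))
    F≡-s : F ≡ ℤ.- + s
    F≡-s = trans (sym (ℤ.neg-involutive F)) (cong ℤ.-_ (sym (trans s≡⌈x⌉ ⌈x⌉≡-F)))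
    -a<[F+1]D : ℤ.- a ℤ.< ℤ.suc F ℤ.* D
    -a<[F+1]D = subst (λ q → ℤ.- a ℤ.< ℤ.suc q ℤ.* D) (sym (div-pos-is-/ℕ (ℤ.- a) (suc b)))
                      (n<s[n/ℕd]*d (ℤ.- a) (suc b))
    -- negating, and using F = - s: (s - 1)·D < a, i.e. s - 1 < x
    [s-1]D<a : (+ s ℤ.- 1ℤ) ℤ.* D ℤ.< a
    [s-1]D<a = subst₂ ℤ._<_
      (trans (cong (λ q → ℤ.- (ℤ.suc q ℤ.* D)) F≡-s)
             (solve 2 (λ s d → :- ((con 1ℤ :+ :- s) :* d) := (s :- con 1ℤ) :* d) refl (+ s) D))
      (ℤ.neg-involutive a)
      (ℤ.neg-mono-< -a<[F+1]D)
    s-1<x : fromℤ (+ s ℤ.- 1ℤ) < x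
    s-1<x = *<* (subst ((+ s ℤ.- 1ℤ) ℤ.* D ℤ.<_) (sym (ℤ.*-identityʳ a)) [s-1]D<a)

  +-cancelʳ-< : ∀ c {p q} → p + c < q + c → p < q
  +-cancelʳ-< c {p} {q} = subst₂ _<_ (drop c p) (drop c q) ∘ +-monoˡ-< (- c)
    where
    drop : ∀ c p → p + c + - c ≡ p
    drop c p = trans (+-assoc p c (- c)) (trans (cong (_+_ p) (+-inverseʳ c)) (+-identityʳ p))

  batch-remainder : (ε : ℚ) (ε>0 : 0ℚ < ε) {m s t : ℕ} → m ≡ t ℕ.+ s → + s ≡ batchSize ε ε>0 m →
                    toℚ m * toℚ 2 < toℚ (suc t) * (toℚ 2 + ε)
  batch-remainder ε ε>0 {m} {s} {t} m≡t+s s≡⌈x⌉ = +-cancelʳ-< (S * P) (begin-strict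
    toℚ m * two + S * P           <⟨ +-monoʳ-< (toℚ m * two) sP<mε+P ⟩
    toℚ m * two + (toℚ m * ε + P) ≡⟨ cong (λ M → M * two + (M * ε + P)) toℚm≡T+S ⟩
    (T + S) * two + ((T + S) * ε + P)
      ≡⟨ solve 4 (λ T S ε two → (T :+ S) :* two :+ ((T :+ S) :* ε :+ (two :+ ε))
                               := (con 1ℚ :+ T) :* (two :+ ε) :+ S :* (two :+ ε)) refl T S ε two ⟩
    (1ℚ + T) * P + S * P          ≡⟨ cong (λ q → q * P + S * P) (sym (toℚ-+ 1 t)) ⟩
    toℚ (suc t) * P + S * P       ∎)
    where
    open ≤-Reasoning
    open import Data.Rational.Solver using (module +-*-Solver)
    open +-*-Solver
    two = toℚ 2
    P = two + ε
    T = toℚ t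
    S = toℚ s
    instance
      P-pos : Positive P
      P-pos = pos+pos⇒pos two ε {{positive ε>0}}
      P-nonZero : NonZero P
      P-nonZero = pos⇒nonZero P
    toℚm≡T+S : toℚ m ≡ T + S
    toℚm≡T+S = trans (cong toℚ m≡t+s) (toℚ-+ t s)
    -- s < mε/P + 1, i.e. sP < mε + P
    sP<mε+P : S * P < toℚ m * ε + P
    sP<mε+P = subst (S * P <_) [x+1]P≡mε+P (*-monoˡ-<-pos P (ceiling-< ((toℚ m * ε) ÷ P) s≡⌈x⌉))
      where
      [x+1]P≡mε+P : ((toℚ m * ε) ÷ P + 1ℚ) * P ≡ toℚ m * ε + P
      [x+1]P≡mε+P = trans (*-distribʳ-+ P ((toℚ m * ε) ÷ P) 1ℚ)
        (cong₂ _+_ (trans (*-assoc (toℚ m * ε) (1/ P) P)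
                     (trans (cong (toℚ m * ε *_) (*-inverseˡ P)) (*-identityʳ (toℚ m * ε))))
                   (*-identityˡ P))

  degree-from-count : (P : ℚ) {m t D d : ℕ} →
                      suc t ℕ.* D ℕ.≤ m ℕ.* (2 ℕ.* d) → toℚ m * toℚ 2 < toℚ (suc t) * P →
                      toℚ D ≤ P * toℚ d
  degree-from-count P {m} {t} {D} {d} count 2m<[t+1]P = *-cancelˡ-≤-pos (toℚ (suc t)) (begin
    toℚ (suc t) * toℚ D          ≡⟨ sym (toℚ-* (suc t) D) ⟩
    toℚ (suc t ℕ.* D)            ≤⟨ toℚ-mono-≤ count ⟩
    toℚ (m ℕ.* (2 ℕ.* d))        ≡⟨ trans (toℚ-* m (2 ℕ.* d)) (cong (toℚ m *_) (toℚ-* 2 d)) ⟩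
    toℚ m * (toℚ 2 * toℚ d)      ≡⟨ sym (*-assoc (toℚ m) (toℚ 2) (toℚ d)) ⟩
    toℚ m * toℚ 2 * toℚ d        ≤⟨ *-monoʳ-≤-nonNeg (toℚ d) (<⇒≤ 2m<[t+1]P) ⟩
    toℚ (suc t) * P * toℚ d      ≡⟨ *-assoc (toℚ (suc t)) P (toℚ d) ⟩
    toℚ (suc t) * (P * toℚ d)    ∎)
    where
    open ≤-Reasoning
    instance
      t+1-pos : Positive (toℚ (suc t))
      t+1-pos = normalize-pos (suc t) 1
      d-nonNeg : NonNegative (toℚ d)
      d-nonNeg = normalize-nonNeg d 1

module Runs where

  open SubsetSums
  open InducedDegrees
  open Arithmetic using (toℚ; toℚ-mono-≤)
  open import Defs hiding (sym)
  open import Data.Nat as ℕ using (ℕ; _+_; _≤_)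
  import Data.Nat.Properties as ℕ
  open import Data.Fin using (Fin)
  open import Data.Fin.Subset using (Subset; _∈_; _⊆_; ∣_∣)
  open import Data.Fin.Subset.Properties using (_∈?_; x∈p∧x∉q⇒x∈p─q; p─q⊆p)
  open import Data.List using (List; []; _∷_; _++_; map)
  open import Data.Nat.ListAction using (sum)
  open import Data.List.Membership.Propositional using () renaming (_∈_ to _∈ₗ_)
  open import Data.List.Membership.Propositional.Properties using (∈-++⁺ˡ; ∈-++⁺ʳ; ∈-++⁻)
  open import Data.List.Relation.Unary.Any using () renaming (here to hereₗ; there to thereₗ)
  open import Data.List.Relation.Unary.AllPairs using ([]; _∷_)
  open import Data.List.Relation.Unary.Unique.Propositional using (Unique)
  open import Data.List.Relation.Unary.Unique.Propositional.Properties using (++⁺)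
  open import Data.Integer using (+_)
  open import Data.Rational as ℚ using (ℚ; 0ℚ)
  import Data.Rational.Properties as ℚ
  open import Data.Product using (_×_; _,_)
  open import Data.Sum using (inj₁; inj₂)
  open import Data.Unit using (tt)
  open import Relation.Nullary using (¬_; yes; no; contradiction)
  open import Relation.Binary.PropositionalEquality
  open import Function using (_∘_)
  open import Function.Bundles using (Equivalence)

  private
    variable
      n : ℕ

  record Enumerates (R : Subset n) (L : List (Fin n)) : Set where
    field
      sound    : ∀ {v} → v ∈ₗ L → v ∈ R
      complete : ∀ {v} → v ∈ R → v ∈ₗ L
      unique   : Unique L

  -- The output of a run from R lists the vertices of R, each exactly once:
  -- every batch S is listed exactly once and the rest of the run lists R ─ S.
  run-enumerates : {G : Graph n} {ε : ℚ} {ε>0 : 0ℚ ℚ.< ε} {R : Subset n} {L : List (Fin n)} →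
                   Run G ε ε>0 R L → Enumerates R L
  run-enumerates (done empty) = record
    { sound    = λ ()
    ; complete = λ v∈R → contradiction (_ , v∈R) empty
    ; unique   = []
    }
  run-enumerates (step {R = R} {S} {ℓS} _ S⊆R _ _ uniqueS S⇔ℓS rest) = record
    { sound    = sound
    ; complete = complete
    ; unique   = ++⁺ uniqueS Rest.unique disjoint
    }
    where
    module Rest = Enumerates (run-enumerates rest)
    sound : ∀ {v} → v ∈ₗ ℓS ++ _ → v ∈ R
    sound {v} v∈L with ∈-++⁻ ℓS v∈L
    ... | inj₁ v∈ℓS = S⊆R (Equivalence.from (S⇔ℓS v) v∈ℓS)
    ... | inj₂ v∈ℓ  = p─q⊆p R S (Rest.sound v∈ℓ)
    complete : ∀ {v} → v ∈ R → v ∈ₗ ℓS ++ _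
    complete {v} v∈R with v ∈? S
    ... | yes v∈S = ∈-++⁺ˡ (Equivalence.to (S⇔ℓS v) v∈S)
    ... | no  v∉S = ∈-++⁺ʳ ℓS (Rest.complete (x∈p∧x∉q⇒x∈p─q v∈R v∉S))
    disjoint : ∀ {v} → ¬ (v ∈ₗ ℓS × v ∈ₗ _)
    disjoint {v} (v∈ℓS , v∈ℓ) = ∈─⇒∉ R S (Rest.sound v∈ℓ) (Equivalence.from (S⇔ℓS v) v∈ℓS)

  nbrsIn-sum : (G : Graph n) (v : Fin n) (us : List (Fin n)) →
               nbrsIn G v us ≡ sum (map (λ u → χ (adj G v u)) us)
  nbrsIn-sum G v []       = refl
  nbrsIn-sum G v (u ∷ us) = cong (_+_ (χ (adj G v u))) (nbrsIn-sum G v us)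

  nbrsIn-≤-deg : (G : Graph n) {R : Subset n} (v : Fin n) {us : List (Fin n)} →
                 Unique us → (∀ {u} → u ∈ₗ us → u ∈ R) → nbrsIn G v us ≤ deg G R v
  nbrsIn-≤-deg G {R} v {us} uniq us⊆R = begin
    nbrsIn G v us                         ≡⟨ nbrsIn-sum G v us ⟩
    sum (map (λ u → χ (adj G v u)) us)    ≤⟨ ∑∈-list (λ u → χ (adj G v u)) uniq us⊆R ⟩
    ∑∈ R (λ u → χ (adj G v u))            ≡⟨ sym (deg-∑∈ G R v) ⟩
    deg G R v                             ∎
    where open ℕ.≤-Reasoning

  afterBound-++ : (G : Graph n) {R : Subset n} {δ : ℚ} (xs : List (Fin n)) {ys : List (Fin n)} →
                  (∀ {u} → u ∈ₗ xs ++ ys → u ∈ R) → Unique (xs ++ ys) →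
                  (∀ {x} → x ∈ₗ xs → toℚ (deg G R x) ℚ.≤ δ) →
                  AfterBound G δ ys → AfterBound G δ (xs ++ ys)
  afterBound-++ G []       inR uniq       small after = after
  afterBound-++ G (x ∷ xs) inR (_ ∷ uniq) small after =
    ℚ.≤-trans (toℚ-mono-≤ (nbrsIn-≤-deg G x uniq (inR ∘ thereₗ))) (small (hereₗ refl)) ,
    afterBound-++ G xs (inR ∘ thereₗ) uniq (small ∘ thereₗ) after

  BatchBound : Graph n → (ε : ℚ) → 0ℚ ℚ.< ε → ℚ → Set
  BatchBound G ε ε>0 δ = ∀ {R S v} → S ⊆ R → + ∣ S ∣ ≡ batchSize ε ε>0 ∣ R ∣ →
                         LowestDegrees G R S → v ∈ S → toℚ (deg G R v) ℚ.≤ δ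

  run-afterBound : {G : Graph n} {ε : ℚ} {ε>0 : 0ℚ ℚ.< ε} {δ : ℚ}
                   {R : Subset n} {L : List (Fin n)} →
                   BatchBound G ε ε>0 δ → Run G ε ε>0 R L → AfterBound G δ L
  run-afterBound bound (done _) = tt
  run-afterBound {G = G} bound run@(step {ℓS = ℓS} _ S⊆R size lowest _ S⇔ℓS rest) =
    afterBound-++ G ℓS sound unique
      (λ {x} x∈ℓS → bound S⊆R size lowest (Equivalence.from (S⇔ℓS x) x∈ℓS))
      (run-afterBound bound rest)
    where open Enumerates (run-enumerates run)

open import Defs
open import Data.Nat using (ℕ)
open import Data.Fin using (Fin)
open import Data.Fin.Subset using (⊤)
open import Data.List using (List)
open import Data.Integer using (+_)
open import Data.Rational using (ℚ; 0ℚ; _<_; _+_; _*_; _/_)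

open import Data.Nat using (suc)
open import Data.Nat.Properties using (1+n≰n; ≤-trans)
open import Data.Product using (_,_)
open import Data.Fin.Subset using (∣_∣; _─_)
open import Data.Fin.Subset.Properties using (∈⊤)
open import Relation.Nullary using (¬_)
open SubsetSums using (∣∣-split)
open InducedDegrees using (degSum-bound; batch-degree)
open Arithmetic using (toℚ; batch-remainder; degree-from-count)
open Runs using (Enumerates; run-enumerates; BatchBound; run-afterBound)

batch-vertex-degree : ∀ {n} {G : Graph n} {d : ℕ} (ε : ℚ) (ε>0 : 0ℚ < ε) →
                      ¬ HasCore G (suc d) → BatchBound G ε ε>0 ((toℚ 2 + ε) * toℚ d)
batch-vertex-degree {G = G} {d} ε ε>0 noCore {R} {S} {v} S⊆R size lowest v∈S =
  degree-from-count (toℚ 2 + ε) {∣ R ∣} {∣ R ─ S ∣} {deg G R v} {d}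
    (≤-trans (batch-degree G S⊆R lowest v∈S) (degSum-bound {G = G} noCore R))
    (batch-remainder ε ε>0 (∣∣-split S⊆R) size)

lemma1 : ∀ {n : ℕ} (G : Graph n) (d : ℕ) (ε : ℚ) (ε>0 : 0ℚ < ε) →
    Degenerate G d →
    (L : List (Fin n)) → Run G ε ε>0 ⊤ L →
    IsDegeneracyOrdering G (((+ 2 / 1) + ε) * (+ d / 1)) L
lemma1 G d ε ε>0 (_ , cores≤d) L run =
  (λ v → complete ∈⊤) , unique , run-afterBound (batch-vertex-degree {G = G} {d} ε ε>0 noCore) run
  where
  open Enumerates (run-enumerates run)
  noCore : ¬ HasCore G (suc d)
  noCore core = 1+n≰n (cores≤d (suc d) core)
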